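{- Let $S$ and $T$ be monads on $\mathbf{Set}$ presented by algebraic theories $\mathbb S$ and $\mathbb T$ such that: for all $\mathbb S$-terms $s',s''$, if $s'$ has no variables and $s'=_{\mathbb S}s''$ then $s''$ has no variables; for every $\mathbb S$-term $s'$ and variable $x$, if $s'=_{\mathbb S}x$ then $\mathrm{var}(s')\subseteq\{x\}$; for every $\mathbb S$-term $s'$ with at least one variable there is a substitution $f$ from $\mathrm{var}(s')$ to $\mathbb S$-terms with $s'[f(y)/y\neq x]=_{\mathbb S}x$ for all $x\in\mathrm{var}(s')$; the same two variable conditions (closed terms are only provably equal to closed terms; a term provably equal to a variable $x$ has no variable other than $x$) hold for $\mathbb T$; $\mathbb T$ has a constant; there are binary terms $s$ of $\mathbb S$ and $t$ of $\mathbb T$ and constants $e_s$ of $\mathbb S$ and $e_t$ of $\mathbb T$ with $s(x,e_s)=_{\mathbb S}x=_{\mathbb S}s(e_s,x)$, $t(x,e_t)=_{\mathbb T}x=_{\mathbb T}t(e_t,x)$; and for all variables $x,y,z,w$, if $t(t(x,y),t(z,w))=_{\mathbb T}t(t(x,z),t(y,w))$ then at most three of $x,y,z,w$ are distinct. Then there is no distributive law $S\circ T\Rightarrow T\circ S$.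
   Context: An algebraic theory consists of a signature and equations; $=_{\mathbb T}$ is provable equality; $\mathrm{var}(u)$ is the set of variables of $u$; $u[f(y)/y\neq x]$ substitutes $f(y)$ for every variable $y\neq x$; a constant is a $0$-ary operation. A monad on $\mathbf{Set}$ is $\langle T,\eta,\mu\rangle$ with $\mu\cdot T\eta=\mathrm{id}=\mu\cdot\eta T$, $\mu\cdot T\mu=\mu\cdot\mu T$. A theory presents a monad if the monad is isomorphic to its free model monad ($X\mapsto$ terms over $X$ modulo provable equality, unit including variables, multiplication flattening). A distributive law $S\circ T\Rightarrow T\circ S$ is a natural transformation $\lambda:ST\Rightarrow TS$ with $\lambda\cdot\eta^S T=T\eta^S$, $\lambda\cdot S\eta^T=\eta^T S$, $\lambda\cdot\mu^S T=T\mu^S\cdot\lambda S\cdot S\lambda$, $\lambda\cdot S\mu^T=\mu^T S\cdot T\lambda\cdot\lambda T$. -}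

module Defs where

open import Data.Nat using (ℕ; _≟_)
open import Data.Fin using (Fin; zero; suc)
open import Data.Product using (Σ; ∃; _×_; _,_)
open import Data.Sum using (_⊎_)
open import Data.Empty using (⊥; ⊥-elim)
open import Relation.Nullary using (¬_; yes; no; Dec)
open import Relation.Binary.PropositionalEquality using (_≡_; subst)
open import Function using (_∘_; id)

record Monad : Set₁ where
  field
    F     : Set → Set
    fmap  : {A B : Set} → (A → B) → F A → F B
    fmap-id   : {A : Set} (m : F A) → fmap id m ≡ m
    fmap-∘    : {A B C : Set} (g : B → C) (f : A → B) (m : F A) →
                fmap (g ∘ f) m ≡ fmap g (fmap f m)
    η     : {A : Set} → A → F A
    μ     : {A : Set} → F (F A) → F A
    η-nat : {A B : Set} (f : A → B) (a : A) → fmap f (η a) ≡ η (f a)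
    μ-nat : {A B : Set} (f : A → B) (m : F (F A)) →
            fmap f (μ m) ≡ μ (fmap (fmap f) m)
    unit-r : {A : Set} (m : F A) → μ (fmap η m) ≡ m
    unit-l : {A : Set} (m : F A) → μ (η m) ≡ m
    assoc  : {A : Set} (m : F (F (F A))) → μ (fmap μ m) ≡ μ (μ m)

record DistributiveLaw (S T : Monad) : Set₁ where
  module S = Monad S
  module T = Monad T
  field
    λ′   : {A : Set} → S.F (T.F A) → T.F (S.F A)
    nat  : {A B : Set} (f : A → B) (m : S.F (T.F A)) →
           λ′ (S.fmap (T.fmap f) m) ≡ T.fmap (S.fmap f) (λ′ m)
    law-ηS : {A : Set} (m : T.F A) → λ′ (S.η m) ≡ T.fmap S.η m
    law-ηT : {A : Set} (m : S.F A) → λ′ (S.fmap T.η m) ≡ T.η m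
    law-μS : {A : Set} (m : S.F (S.F (T.F A))) →
             λ′ (S.μ m) ≡ T.fmap S.μ (λ′ (S.fmap λ′ m))
    law-μT : {A : Set} (m : S.F (T.F (T.F A))) →
             λ′ (S.fmap T.μ m) ≡ T.μ (T.fmap λ′ (λ′ m))

record Signature : Set₁ where
  field
    Op    : Set
    arity : Op → ℕ
open Signature public

data Term (Σ′ : Signature) (X : Set) : Set where
  var : X → Term Σ′ X
  op  : (o : Op Σ′) → (Fin (arity Σ′ o) → Term Σ′ X) → Term Σ′ X

module _ {Σ′ : Signature} where

  _[_] : {X Y : Set} → Term Σ′ X → (X → Term Σ′ Y) → Term Σ′ Y
  var x  [ σ ] = σ x
  op o ts [ σ ] = op o (λ i → ts i [ σ ])

  data _∈var_ {X : Set} (x : X) : Term Σ′ X → Set where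
    here  : x ∈var var x
    there : {o : Op Σ′} {ts : Fin (arity Σ′ o) → Term Σ′ X} (i : Fin (arity Σ′ o)) →
            x ∈var ts i → x ∈var op o ts

  Closed : {X : Set} → Term Σ′ X → Set
  Closed u = ∀ x → ¬ (x ∈var u)

  constTerm : {X : Set} (o : Op Σ′) → arity Σ′ o ≡ 0 → Term Σ′ X
  constTerm o p = op o (λ i → fin0 (subst Fin p i))
    where
      fin0 : {A : Set} → Fin 0 → A
      fin0 ()

  apply₂ : {X : Set} → Term Σ′ (Fin 2) → Term Σ′ X → Term Σ′ X → Term Σ′ X
  apply₂ b u v = b [ (λ { zero → u ; (suc zero) → v }) ]

substExcept : {Σ′ : Signature} → Term Σ′ ℕ → ℕ → (ℕ → Term Σ′ ℕ) → Term Σ′ ℕ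
substExcept u x f = u [ (λ y → sel y (y ≟ x)) ]
  where
    sel : ∀ y → Dec (y ≡ x) → _
    sel y (yes _) = var y
    sel y (no _)  = f y

record Theory : Set₁ where
  field
    sig : Signature
    Ax  : Set
    lhs : Ax → Term sig ℕ
    rhs : Ax → Term sig ℕ
open Theory public

data Prov (𝕋 : Theory) {X : Set} : Term (sig 𝕋) X → Term (sig 𝕋) X → Set where
  ax     : (a : Ax 𝕋) (σ : ℕ → Term (sig 𝕋) X) → Prov 𝕋 (lhs 𝕋 a [ σ ]) (rhs 𝕋 a [ σ ])
  prefl  : ∀ {u} → Prov 𝕋 u u
  psym   : ∀ {u v} → Prov 𝕋 u v → Prov 𝕋 v u
  ptrans : ∀ {u v w} → Prov 𝕋 u v → Prov 𝕋 v w → Prov 𝕋 u w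
  pcong  : ∀ o {ts us : Fin (arity (sig 𝕋) o) → Term (sig 𝕋) X} →
           (∀ i → Prov 𝕋 (ts i) (us i)) → Prov 𝕋 (op o ts) (op o us)

-- 𝕋 presents M: an isomorphism of monads between the free-model monad
-- X ↦ Term X / =_𝕋 and M.  Since Agda has no quotient types, this is
-- given as a natural family φ : Term X → M X that is surjective, whose
-- kernel is exactly =_𝕋, and which preserves unit and multiplication.

module _ {Σ′ : Signature} where
  rename : {X Y : Set} → (X → Y) → Term Σ′ X → Term Σ′ Y
  rename f u = u [ var ∘ f ]

  flatten : {X : Set} → Term Σ′ (Term Σ′ X) → Term Σ′ X
  flatten u = u [ id ]

record Presents (𝕋 : Theory) (M : Monad) : Set₁ where
  open Monad M
  field
    φ          : {X : Set} → Term (sig 𝕋) X → F X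
    φ-surj     : {X : Set} (m : F X) → ∃ λ u → φ u ≡ m
    φ-sound    : {X : Set} {u v : Term (sig 𝕋) X} → Prov 𝕋 u v → φ u ≡ φ v
    φ-complete : {X : Set} {u v : Term (sig 𝕋) X} → φ u ≡ φ v → Prov 𝕋 u v
    φ-nat      : {X Y : Set} (f : X → Y) (u : Term (sig 𝕋) X) →
                 φ (rename f u) ≡ fmap f (φ u)
    φ-η        : {X : Set} (x : X) → φ (var x) ≡ η x
    φ-μ        : {X : Set} (u : Term (sig 𝕋) (Term (sig 𝕋) X)) →
                 φ (flatten u) ≡ μ (fmap φ (φ u))

ClosedStable : Theory → Set
ClosedStable 𝕋 = (u v : Term (sig 𝕋) ℕ) → Closed u → Prov 𝕋 u v → Closed v

VarStable : Theory → Set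
VarStable 𝕋 = (u : Term (sig 𝕋) ℕ) (x : ℕ) → Prov 𝕋 u (var x) →
              ∀ y → y ∈var u → y ≡ x

Cancellative : Theory → Set
Cancellative 𝕋 = (u : Term (sig 𝕋) ℕ) → (∃ λ x → x ∈var u) →
  ∃ λ (f : ℕ → Term (sig 𝕋) ℕ) → ∀ x → x ∈var u → Prov 𝕋 (substExcept u x f) (var x)

HasConstant : Theory → Set
HasConstant 𝕋 = ∃ λ (o : Op (sig 𝕋)) → arity (sig 𝕋) o ≡ 0

HasUnit : (𝕋 : Theory) → Term (sig 𝕋) (Fin 2) → (e : Op (sig 𝕋)) → arity (sig 𝕋) e ≡ 0 → Set
HasUnit 𝕋 b e p = ∀ (x : ℕ) →
  Prov 𝕋 (apply₂ b (var x) (constTerm e p)) (var x) ×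
  Prov 𝕋 (apply₂ b (constTerm e p) (var x)) (var x)

AtMostThreeDistinct : ℕ → ℕ → ℕ → ℕ → Set
AtMostThreeDistinct x y z w =
  x ≡ y ⊎ x ≡ z ⊎ x ≡ w ⊎ y ≡ z ⊎ y ≡ w ⊎ z ≡ w

MedialRestricted : (𝕋 : Theory) → Term (sig 𝕋) (Fin 2) → Set
MedialRestricted 𝕋 t = ∀ (x y z w : ℕ) →
  Prov 𝕋 (apply₂ t (apply₂ t (var x) (var y)) (apply₂ t (var z) (var w)))
         (apply₂ t (apply₂ t (var x) (var z)) (apply₂ t (var y) (var w))) →
  AtMostThreeDistinct x y z w

module Submission where

-- Given a distributive law λ, the key computation is λ(s(t(p,q),r)) = t(s(p,r),s(q,r)) for
-- distinct variables p, q, r. Substituting the unit of t for q (resp. p) and using that a 𝕋-term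
-- equal to a variable mentions no other variable shows that every leaf of λ(s(t(p,q),r)) not
-- mentioning q is s(p,r) (resp. not mentioning p is s(q,r)); substituting the unit of s for r rules
-- out leaves mentioning both. Expanding λ(s(t(0,1),t(2,3))) through the left and then the right
-- argument, and alternatively in the opposite order, yields
--   t(t(s(0,2),s(0,3)),t(s(1,2),s(1,3))) = t(t(s(0,2),s(1,2)),t(s(0,3),s(1,3))),
-- a medial law in four distinct variables, which 𝕋 forbids. As S ℕ need not have decidable
-- equality, the analysis of leaves takes place in the double-negation monad.

open import Defs
open import Data.Fin using (Fin; zero; suc)
open import Data.Fin.Properties using (any?; sequence)
open import Data.Nat using (ℕ; _≟_)
open import Data.Product using (∃; _×_; _,_; proj₁; proj₂)
open import Data.Sum using (_⊎_; inj₁; inj₂)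
import Data.Bool as Bool
open import Data.Empty using (⊥; ⊥-elim)
open import Effect.Monad using (RawMonad)
open import Function using (_∘_; id)
open import Level using (0ℓ)
open import Relation.Binary.Bundles using (Setoid)
open import Relation.Binary.Definitions using (DecidableEquality)
import Relation.Binary.Reasoning.Setoid as SetoidReasoning
open import Relation.Binary.PropositionalEquality
  using (_≡_; refl; sym; trans; cong; cong₂; subst; module ≡-Reasoning)
open import Relation.Nullary using (¬_; Dec; yes; no; does)
open import Relation.Nullary.Decidable using (¬¬-excluded-middle; dec-true; dec-false)
open import Relation.Nullary.Negation using (DoubleNegation; ¬¬-Monad)

open RawMonad (¬¬-Monad {0ℓ}) using (pure; _<$>_; _>>=_; rawApplicative)

¬¬-sequence : ∀ {n} {P : Fin n → Set} → (∀ i → DoubleNegation (P i)) → DoubleNegation (∀ i → P i)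
¬¬-sequence = sequence rawApplicative

private
  variable
    X Y Z : Set

module _ {Σ′ : Signature} where

  ∈var-op⁻ : {x : X} {o : Op Σ′} {ts : Fin (arity Σ′ o) → Term Σ′ X} →
             x ∈var op o ts → ∃ λ i → x ∈var ts i
  ∈var-op⁻ (there i m) = i , m

  ∈var-[]⁻ : (u : Term Σ′ X) (σ : X → Term Σ′ Y) {y : Y} →
             y ∈var (u [ σ ]) → ∃ λ x → x ∈var u × y ∈var σ x
  ∈var-[]⁻ (var x)   σ m = x , here , m
  ∈var-[]⁻ (op o ts) σ (there i m) with ∈var-[]⁻ (ts i) σ m
  ... | x , mx , my = x , there i mx , my

  ∈var-[]⁺ : (u : Term Σ′ X) (σ : X → Term Σ′ Y) {x : X} {y : Y} →
             x ∈var u → y ∈var σ x → y ∈var (u [ σ ])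
  ∈var-[]⁺ (var x)   σ here         my = my
  ∈var-[]⁺ (op o ts) σ (there i mx) my = there i (∈var-[]⁺ (ts i) σ mx my)

  ∈var? : DecidableEquality X → (u : Term Σ′ X) (x : X) → Dec (x ∈var u)
  ∈var? _≟ˣ_ (var y) x with x ≟ˣ y
  ... | yes refl = yes here
  ... | no x≢y   = no λ { here → x≢y refl }
  ∈var? _≟ˣ_ (op o ts) x with any? (λ i → ∈var? _≟ˣ_ (ts i) x)
  ... | yes (i , m) = yes (there i m)
  ... | no ∉ts      = no (∉ts ∘ ∈var-op⁻)

  ¬¬-∀∈var : (u : Term Σ′ X) {Q : X → Set} →
             (∀ x → x ∈var u → DoubleNegation (Q x)) → DoubleNegation (∀ x → x ∈var u → Q x)
  ¬¬-∀∈var (var y) q = (λ qy → λ { _ here → qy }) <$> q y here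
  ¬¬-∀∈var (op o ts) q =
    (λ qs x m → qs (proj₁ (∈var-op⁻ m)) x (proj₂ (∈var-op⁻ m)))
      <$> ¬¬-sequence (λ i → ¬¬-∀∈var (ts i) (λ x m → q x (there i m)))

  constTerm-closed : (o : Op Σ′) (p : arity Σ′ o ≡ 0) → Closed (constTerm {Σ′ = Σ′} {X = X} o p)
  constTerm-closed o p x (there i m) with subst Fin p i
  ... | ()

  apply₂-∈var : (b : Term Σ′ (Fin 2)) {x y z : X} →
                z ∈var apply₂ b (var x) (var y) → z ≡ x ⊎ z ≡ y
  apply₂-∈var b m with ∈var-[]⁻ b _ m
  ... | zero     , _ , here = inj₁ refl
  ... | suc zero , _ , here = inj₂ refl

_↦_ : {Σ′ : Signature} → ℕ → Term Σ′ ℕ → ℕ → Term Σ′ ℕ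
(k ↦ u) n with n ≟ k
... | yes _ = u
... | no _  = var n

↦-here : {Σ′ : Signature} (k : ℕ) (u : Term Σ′ ℕ) → (k ↦ u) k ≡ u
↦-here k u with k ≟ k
... | yes _ = refl
... | no k≢k = ⊥-elim (k≢k refl)

↦-there : {Σ′ : Signature} {k n : ℕ} (u : Term Σ′ ℕ) → ¬ n ≡ k → (k ↦ u) n ≡ var n
↦-there {k = k} {n} u n≢k with n ≟ k
... | yes n≡k = ⊥-elim (n≢k n≡k)
... | no _    = refl

opposite : {Σ′ : Signature} → Term Σ′ (Fin 2) → Term Σ′ (Fin 2)
opposite b = b [ (λ { zero → var (suc zero) ; (suc zero) → var zero }) ]

module Provability (𝕋 : Theory) where

  ≈-setoid : Set → Setoid 0ℓ 0ℓ
  ≈-setoid X = record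
    { Carrier       = Term (sig 𝕋) X
    ; _≈_           = Prov 𝕋
    ; isEquivalence = record { refl = prefl ; sym = psym ; trans = ptrans }
    }

  module ≈-Reasoning {X : Set} = SetoidReasoning (≈-setoid X)

  ≡⇒Prov : {u v : Term (sig 𝕋) X} → u ≡ v → Prov 𝕋 u v
  ≡⇒Prov refl = prefl

  []-congʳ : (u : Term (sig 𝕋) X) {σ τ : X → Term (sig 𝕋) Y} →
             (∀ x → x ∈var u → Prov 𝕋 (σ x) (τ x)) → Prov 𝕋 (u [ σ ]) (u [ τ ])
  []-congʳ (var x)   στ = στ x here
  []-congʳ (op o ts) στ = pcong o (λ i → []-congʳ (ts i) (λ x m → στ x (there i m)))

  []-assoc : (u : Term (sig 𝕋) X) (σ : X → Term (sig 𝕋) Y) (τ : Y → Term (sig 𝕋) Z) →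
             Prov 𝕋 ((u [ σ ]) [ τ ]) (u [ (λ x → σ x [ τ ]) ])
  []-assoc (var x)   σ τ = prefl
  []-assoc (op o ts) σ τ = pcong o (λ i → []-assoc (ts i) σ τ)

  []-identity : (u : Term (sig 𝕋) X) → Prov 𝕋 (u [ var ]) u
  []-identity (var x)   = prefl
  []-identity (op o ts) = pcong o (λ i → []-identity (ts i))

  []-congˡ : {u v : Term (sig 𝕋) X} (σ : X → Term (sig 𝕋) Y) →
             Prov 𝕋 u v → Prov 𝕋 (u [ σ ]) (v [ σ ])
  []-congˡ σ (ax a τ)     = ptrans ([]-assoc (lhs 𝕋 a) τ σ)
                              (ptrans (ax a (λ n → τ n [ σ ])) (psym ([]-assoc (rhs 𝕋 a) τ σ)))
  []-congˡ σ prefl        = prefl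
  []-congˡ σ (psym p)     = psym ([]-congˡ σ p)
  []-congˡ σ (ptrans p q) = ptrans ([]-congˡ σ p) ([]-congˡ σ q)
  []-congˡ σ (pcong o ps) = pcong o (λ i → []-congˡ σ (ps i))

  constTerm-[] : (o : Op (sig 𝕋)) (p : arity (sig 𝕋) o ≡ 0) (σ : X → Term (sig 𝕋) Y) →
                 Prov 𝕋 (constTerm o p [ σ ]) (constTerm o p)
  constTerm-[] o p σ = pcong o (λ i → ⊥-elim (fin0 (subst Fin p i)))
    where
      fin0 : Fin 0 → ⊥
      fin0 ()

  apply₂-cong : (b : Term (sig 𝕋) (Fin 2)) {u u′ v v′ : Term (sig 𝕋) X} →
                Prov 𝕋 u u′ → Prov 𝕋 v v′ → Prov 𝕋 (apply₂ b u v) (apply₂ b u′ v′)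
  apply₂-cong b pu pv = []-congʳ b (λ { zero _ → pu ; (suc zero) _ → pv })

  apply₂-[] : (b : Term (sig 𝕋) (Fin 2)) (u v : Term (sig 𝕋) X) (σ : X → Term (sig 𝕋) Y) →
              Prov 𝕋 (apply₂ b u v [ σ ]) (apply₂ b (u [ σ ]) (v [ σ ]))
  apply₂-[] b u v σ = ptrans ([]-assoc b _ σ) ([]-congʳ b (λ { zero _ → prefl ; (suc zero) _ → prefl }))

  apply₂-opposite : (b : Term (sig 𝕋) (Fin 2)) (u v : Term (sig 𝕋) X) →
                    Prov 𝕋 (apply₂ (opposite b) u v) (apply₂ b v u)
  apply₂-opposite b u v = ptrans ([]-assoc b _ _) ([]-congʳ b (λ { zero _ → prefl ; (suc zero) _ → prefl }))

RightUnit LeftUnit : (𝕋 : Theory) → Term (sig 𝕋) (Fin 2) → (e : Op (sig 𝕋)) → arity (sig 𝕋) e ≡ 0 → Set₁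
RightUnit 𝕋 b e p = ∀ {X : Set} (x : X) → Prov 𝕋 (apply₂ b (var x) (constTerm e p)) (var x)
LeftUnit  𝕋 b e p = ∀ {X : Set} (x : X) → Prov 𝕋 (apply₂ b (constTerm e p) (var x)) (var x)

module _ {𝕋 : Theory} (b : Term (sig 𝕋) (Fin 2)) {e : Op (sig 𝕋)} {p : arity (sig 𝕋) e ≡ 0} where
  open Provability 𝕋

  HasUnit⇒RightUnit : HasUnit 𝕋 b e p → RightUnit 𝕋 b e p
  HasUnit⇒RightUnit unit x =
    ptrans (apply₂-cong b prefl (psym (constTerm-[] e p (λ _ → var x))))
      (ptrans (psym (apply₂-[] b (var 0) (constTerm e p) (λ _ → var x)))
        ([]-congˡ (λ _ → var x) (proj₁ (unit 0))))

  HasUnit⇒LeftUnit : HasUnit 𝕋 b e p → LeftUnit 𝕋 b e p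
  HasUnit⇒LeftUnit unit x =
    ptrans (apply₂-cong b (psym (constTerm-[] e p (λ _ → var x))) prefl)
      (ptrans (psym (apply₂-[] b (constTerm e p) (var 0) (λ _ → var x)))
        ([]-congˡ (λ _ → var x) (proj₂ (unit 0))))

  LeftUnit⇒RightUnit-opposite : LeftUnit 𝕋 b e p → RightUnit 𝕋 (opposite b) e p
  LeftUnit⇒RightUnit-opposite unit x = ptrans (apply₂-opposite b _ _) (unit x)

  RightUnit⇒LeftUnit-opposite : RightUnit 𝕋 b e p → LeftUnit 𝕋 (opposite b) e p
  RightUnit⇒LeftUnit-opposite unit x = ptrans (apply₂-opposite b _ _) (unit x)

module Collapse {𝕋 : Theory} (a : X) where
  open Provability 𝕋

  Decisions : Term (sig 𝕋) X → Set
  Decisions u = ∀ y → y ∈var u → Dec (y ≡ a)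

  code : {y : X} → Dec (y ≡ a) → ℕ
  code (yes _) = 0
  code (no _)  = 1

  code-irrelevant : {y : X} (d d′ : Dec (y ≡ a)) → code d ≡ code d′
  code-irrelevant (yes _)   (yes _)   = refl
  code-irrelevant (yes y≡a) (no y≢a)  = ⊥-elim (y≢a y≡a)
  code-irrelevant (no y≢a)  (yes y≡a) = ⊥-elim (y≢a y≡a)
  code-irrelevant (no _)    (no _)    = refl

  collapse : (u : Term (sig 𝕋) X) → Decisions u → Term (sig 𝕋) ℕ
  collapse (var y)   d = var (code (d y here))
  collapse (op o ts) d = op o (λ i → collapse (ts i) (λ y m → d y (there i m)))

  collapse-irrelevant : (u : Term (sig 𝕋) X) (d d′ : Decisions u) → Prov 𝕋 (collapse u d) (collapse u d′)
  collapse-irrelevant (var y)   d d′ = ≡⇒Prov (cong var (code-irrelevant (d y here) (d′ y here)))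
  collapse-irrelevant (op o ts) d d′ = pcong o (λ i → collapse-irrelevant (ts i) _ _)

  code-∈var : (u : Term (sig 𝕋) X) (d : Decisions u) {y : X} (m : y ∈var u) → code (d y m) ∈var collapse u d
  code-∈var (var y)   d here        = here
  code-∈var (op o ts) d (there i m) = there i (code-∈var (ts i) _ m)

  ¬¬-decisions : (u : Term (sig 𝕋) X) → DoubleNegation (Decisions u)
  ¬¬-decisions u = ¬¬-∀∈var u (λ _ _ → ¬¬-excluded-middle)

  collapse-[] : (u : Term (sig 𝕋) ℕ) (σ : ℕ → Term (sig 𝕋) X) (d : Decisions (u [ σ ])) (σ′ : ℕ → Term (sig 𝕋) ℕ) →
                (∀ n (m : n ∈var u) → Prov 𝕋 (σ′ n) (collapse (σ n) (λ y my → d y (∈var-[]⁺ u σ m my)))) →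
                Prov 𝕋 (collapse (u [ σ ]) d) (u [ σ′ ])
  collapse-[] (var n)   σ d σ′ fits = psym (fits n here)
  collapse-[] (op o ts) σ d σ′ fits =
    pcong o (λ i → collapse-[] (ts i) σ _ σ′ (λ n m → fits n (there i m)))

  -- σ′ collapses σ n using whichever side of the equation n occurs in
  collapse-axiom : (l r : Term (sig 𝕋) ℕ) (σ : ℕ → Term (sig 𝕋) X) (dl : Decisions (l [ σ ])) (dr : Decisions (r [ σ ])) →
                   ∃ λ σ′ → Prov 𝕋 (collapse (l [ σ ]) dl) (l [ σ′ ]) × Prov 𝕋 (collapse (r [ σ ]) dr) (r [ σ′ ])
  collapse-axiom l r σ dl dr =
    σ′ , collapse-[] l σ dl σ′ (λ n m → fits n (inj₁ m)) , collapse-[] r σ dr σ′ (λ n m → fits n (inj₂ m))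
    where
      σ′ : ℕ → Term (sig 𝕋) ℕ
      σ′ n with ∈var? _≟_ l n
      ... | yes m = collapse (σ n) (λ y my → dl y (∈var-[]⁺ l σ m my))
      ... | no _ with ∈var? _≟_ r n
      ...   | yes m = collapse (σ n) (λ y my → dr y (∈var-[]⁺ r σ m my))
      ...   | no _  = var 0

      fits : ∀ n {d} → n ∈var l ⊎ n ∈var r → Prov 𝕋 (σ′ n) (collapse (σ n) d)
      fits n occurs with ∈var? _≟_ l n
      ... | yes _ = collapse-irrelevant (σ n) _ _
      ... | no n∉l with ∈var? _≟_ r n
      ...   | yes _ = collapse-irrelevant (σ n) _ _
      fits n (inj₁ n∈l) | no n∉l | no _   = ⊥-elim (n∉l n∈l)
      fits n (inj₂ n∈r) | no _   | no n∉r = ⊥-elim (n∉r n∈r)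

  collapse-Prov : {u v : Term (sig 𝕋) X} → Prov 𝕋 u v → (du : Decisions u) (dv : Decisions v) →
                  DoubleNegation (Prov 𝕋 (collapse u du) (collapse v dv))
  collapse-Prov (ax α σ) dl dr with collapse-axiom (lhs 𝕋 α) (rhs 𝕋 α) σ dl dr
  ... | σ′ , pl , pr = pure (ptrans pl (ptrans (ax α σ′) (psym pr)))
  collapse-Prov {u} prefl du dv = pure (collapse-irrelevant u du dv)
  collapse-Prov (psym p) du dv = psym <$> collapse-Prov p dv du
  collapse-Prov (ptrans {v = w} p q) du dv = do
    dw ← ¬¬-decisions w
    p′ ← collapse-Prov p du dw
    ptrans p′ <$> collapse-Prov q dw dv
  collapse-Prov (pcong o ps) du dv = pcong o <$> ¬¬-sequence (λ i → collapse-Prov (ps i) _ _)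

-- Without decidable equality on X only finitely many instances of excluded middle are available,
-- whence the double negation.
VarStable⇒¬¬ : {𝕋 : Theory} → VarStable 𝕋 → (u : Term (sig 𝕋) X) (a : X) →
               Prov 𝕋 u (var a) → ∀ y → y ∈var u → DoubleNegation (y ≡ a)
VarStable⇒¬¬ vs u a u≈a y y∈u = do
  du ← ¬¬-decisions u
  u≈a′ ← collapse-Prov u≈a du (λ { _ here → yes refl })
  decided (du y y∈u) (vs (collapse u du) 0 u≈a′ (code (du y y∈u)) (code-∈var u du y∈u))
  where
    open Collapse a
    decided : (d : Dec (y ≡ a)) → code d ≡ 0 → DoubleNegation (y ≡ a)
    decided (yes y≡a) _ = pure y≡a
    decided (no _)    ()

module _ {𝕋 : Theory} (closedStable : ClosedStable 𝕋) (e : Op (sig 𝕋)) (pe : arity (sig 𝕋) e ≡ 0) where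
  open Provability 𝕋

  keep : ℕ → ℕ → Term (sig 𝕋) ℕ
  keep n j with j ≟ n
  ... | yes _ = var j
  ... | no _  = constTerm e pe

  keep-∈var : ∀ n → n ∈var keep n n
  keep-∈var n with n ≟ n
  ... | yes _ = here
  ... | no n≢n = ⊥-elim (n≢n refl)

  keep-∈var⁻ : ∀ n j {y} → y ∈var keep n j → j ≡ n
  keep-∈var⁻ n j y∈ with j ≟ n
  ... | yes j≡n = j≡n
  ... | no _    = ⊥-elim (constTerm-closed e pe _ y∈)

  Prov-∈var : {u v : Term (sig 𝕋) ℕ} → Prov 𝕋 u v → ∀ {n} → n ∈var u → n ∈var v
  Prov-∈var {u} {v} u≈v {n} n∈u with ∈var? _≟_ v n
  ... | yes n∈v = n∈v
  ... | no n∉v  = ⊥-elim (closedStable (v [ keep n ]) (u [ keep n ]) v[keep]-closed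
                            (psym ([]-congˡ (keep n) u≈v)) n (∈var-[]⁺ u (keep n) n∈u (keep-∈var n)))
    where
      v[keep]-closed : Closed (v [ keep n ])
      v[keep]-closed y y∈ with ∈var-[]⁻ v (keep n) y∈
      ... | j , j∈v , y∈keep with keep-∈var⁻ n j y∈keep
      ... | refl = n∉v j∈v

module Presented {𝕋 : Theory} {M : Monad} (P : Presents 𝕋 M) where
  open Monad M
  open Presents P
  open Provability 𝕋

  rep : F X → Term (sig 𝕋) X
  rep m = proj₁ (φ-surj m)

  φ-rep : (m : F X) → φ (rep m) ≡ m
  φ-rep m = proj₂ (φ-surj m)

  fmap-cong : {f g : X → Y} (m : F X) → (∀ x → x ∈var rep m → f x ≡ g x) → fmap f m ≡ fmap g m
  fmap-cong {f = f} {g} m f≗g = begin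
    fmap f m              ≡⟨ cong (fmap f) (φ-rep m) ⟨
    fmap f (φ (rep m))    ≡⟨ φ-nat f (rep m) ⟨
    φ (rename f (rep m))  ≡⟨ φ-sound ([]-congʳ (rep m) (λ x x∈ → ≡⇒Prov (cong var (f≗g x x∈)))) ⟩
    φ (rename g (rep m))  ≡⟨ φ-nat g (rep m) ⟩
    fmap g (φ (rep m))    ≡⟨ cong (fmap g) (φ-rep m) ⟩
    fmap g m              ∎
    where open ≡-Reasoning

  φ-[] : (u : Term (sig 𝕋) X) (σ : X → Term (sig 𝕋) Y) {Θ : X → F Y} →
         (∀ x → φ (σ x) ≡ Θ x) → φ (u [ σ ]) ≡ μ (fmap Θ (φ u))
  φ-[] u σ {Θ} φσ≗Θ = begin
    φ (u [ σ ])                     ≡⟨ φ-sound (psym ([]-assoc u (var ∘ σ) id)) ⟩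
    φ (flatten (rename σ u))        ≡⟨ φ-μ (rename σ u) ⟩
    μ (fmap φ (φ (rename σ u)))     ≡⟨ cong (μ ∘ fmap φ) (φ-nat σ u) ⟩
    μ (fmap φ (fmap σ (φ u)))       ≡⟨ cong μ (fmap-∘ φ σ (φ u)) ⟨
    μ (fmap (φ ∘ σ) (φ u))          ≡⟨ cong μ (fmap-cong (φ u) (λ x _ → φσ≗Θ x)) ⟩
    μ (fmap Θ (φ u))                ∎
    where open ≡-Reasoning

  fmap-φ-constTerm : (e : Op (sig 𝕋)) (p : arity (sig 𝕋) e ≡ 0) (f : X → Y) →
                     fmap f (φ (constTerm e p)) ≡ φ (constTerm e p)
  fmap-φ-constTerm e p f = trans (sym (φ-nat f (constTerm e p))) (φ-sound (constTerm-[] e p (var ∘ f)))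

  ⟪_⟫ : Term (sig 𝕋) (Fin 2) → X → X → F X
  ⟪ b ⟫ x y = φ (apply₂ b (var x) (var y))

  fmap-⟪⟫ : (f : X → Y) (b : Term (sig 𝕋) (Fin 2)) (x y : X) → fmap f (⟪ b ⟫ x y) ≡ ⟪ b ⟫ (f x) (f y)
  fmap-⟪⟫ f b x y = trans (sym (φ-nat f _)) (φ-sound (apply₂-[] b (var x) (var y) (var ∘ f)))

  μ-⟪⟫ : (b : Term (sig 𝕋) (Fin 2)) (u v : Term (sig 𝕋) X) → μ (⟪ b ⟫ (φ u) (φ v)) ≡ φ (apply₂ b u v)
  μ-⟪⟫ b u v = begin
    μ (⟪ b ⟫ (φ u) (φ v))                          ≡⟨ cong μ (fmap-⟪⟫ φ b u v) ⟨
    μ (fmap φ (φ (apply₂ b (var u) (var v))))      ≡⟨ φ-μ (apply₂ b (var u) (var v)) ⟨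
    φ (flatten (apply₂ b (var u) (var v)))         ≡⟨ φ-sound (apply₂-[] b (var u) (var v) id) ⟩
    φ (apply₂ b u v)                               ∎
    where open ≡-Reasoning

  ⟪opposite⟫ : (b : Term (sig 𝕋) (Fin 2)) (x y : X) → ⟪ opposite b ⟫ x y ≡ ⟪ b ⟫ y x
  ⟪opposite⟫ b x y = φ-sound (apply₂-opposite b (var x) (var y))

module DistributiveLawProperties {S T : Monad} (DL : DistributiveLaw S T) where
  open DistributiveLaw DL

  λ-fmap-bind : {A B : Set} (h : A → T.F B) (m : S.F (T.F A)) →
                λ′ (S.fmap (T.μ ∘ T.fmap h) m) ≡ T.μ (T.fmap (λ′ ∘ S.fmap h) (λ′ m))
  λ-fmap-bind h m = begin
    λ′ (S.fmap (T.μ ∘ T.fmap h) m)            ≡⟨ cong λ′ (S.fmap-∘ T.μ (T.fmap h) m) ⟩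
    λ′ (S.fmap T.μ (S.fmap (T.fmap h) m))     ≡⟨ law-μT (S.fmap (T.fmap h) m) ⟩
    T.μ (T.fmap λ′ (λ′ (S.fmap (T.fmap h) m)))  ≡⟨ cong (T.μ ∘ T.fmap λ′) (nat h m) ⟩
    T.μ (T.fmap λ′ (T.fmap (S.fmap h) (λ′ m)))  ≡⟨ cong T.μ (T.fmap-∘ λ′ (S.fmap h) (λ′ m)) ⟨
    T.μ (T.fmap (λ′ ∘ S.fmap h) (λ′ m))        ∎
    where open ≡-Reasoning

module Support {𝕋 : Theory} {M : Monad} (P : Presents 𝕋 M)
               (closedStable : ClosedStable 𝕋) (e : Op (sig 𝕋)) (pe : arity (sig 𝕋) e ≡ 0) where
  open Monad M
  open Presents P
  open Presented P

  -- independent of the chosen representative, by Prov-∈var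
  _∈ᴹ_ : ℕ → F ℕ → Set
  n ∈ᴹ m = n ∈var rep m

  _∈ᴹ?_ : ∀ n m → Dec (n ∈ᴹ m)
  n ∈ᴹ? m = ∈var? _≟_ (rep m) n

  if_∈ᴹ_then_else_ : {A : Set} → ℕ → F ℕ → A → A → A
  if n ∈ᴹ m then a else b = Bool.if does (n ∈ᴹ? m) then a else b

  if-∈ᴹ : {A : Set} {n : ℕ} {m : F ℕ} {a b : A} → n ∈ᴹ m → (if n ∈ᴹ m then a else b) ≡ a
  if-∈ᴹ {n = n} {m} n∈ = cong (Bool.if_then _ else _) (dec-true (n ∈ᴹ? m) n∈)

  if-∉ᴹ : {A : Set} {n : ℕ} {m : F ℕ} {a b : A} → ¬ n ∈ᴹ m → (if n ∈ᴹ m then a else b) ≡ b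
  if-∉ᴹ {n = n} {m} n∉ = cong (Bool.if_then _ else _) (dec-false (n ∈ᴹ? m) n∉)

  ∈ᴹ-φ⁺ : {u : Term (sig 𝕋) ℕ} {n : ℕ} → n ∈var u → n ∈ᴹ φ u
  ∈ᴹ-φ⁺ {u} = Prov-∈var closedStable e pe (φ-complete (sym (φ-rep (φ u))))

  ∈ᴹ-φ⁻ : {u : Term (sig 𝕋) ℕ} {n : ℕ} → n ∈ᴹ φ u → n ∈var u
  ∈ᴹ-φ⁻ {u} = Prov-∈var closedStable e pe (φ-complete (φ-rep (φ u)))

  ∈ᴹ-η : ∀ n → n ∈ᴹ η n
  ∈ᴹ-η n = subst (n ∈ᴹ_) (φ-η n) (∈ᴹ-φ⁺ here)

  ∈ᴹ-η⁻ : ∀ {k n} → k ∈ᴹ η n → k ≡ n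
  ∈ᴹ-η⁻ {n = n} k∈ with ∈ᴹ-φ⁻ (subst (_ ∈ᴹ_) (sym (φ-η n)) k∈)
  ... | here = refl

  ∉ᴹ-⟪⟫ : (b : Term (sig 𝕋) (Fin 2)) {x y n : ℕ} → ¬ n ≡ x → ¬ n ≡ y → ¬ n ∈ᴹ ⟪ b ⟫ x y
  ∉ᴹ-⟪⟫ b n≢x n≢y n∈ with apply₂-∈var b (∈ᴹ-φ⁻ n∈)
  ... | inj₁ n≡x = n≢x n≡x
  ... | inj₂ n≡y = n≢y n≡y

  module _ (b : Term (sig 𝕋) (Fin 2)) {e′ : Op (sig 𝕋)} {pe′ : arity (sig 𝕋) e′ ≡ 0} where

    RightUnit⇒∈ᴹ-⟪⟫ˡ : RightUnit 𝕋 b e′ pe′ → ∀ x y → x ∈ᴹ ⟪ b ⟫ x y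
    RightUnit⇒∈ᴹ-⟪⟫ˡ unit x y with ∈var-[]⁻ b _ (Prov-∈var closedStable e pe (psym (unit x)) here)
    ... | zero     , 0∈b , _  = ∈ᴹ-φ⁺ (∈var-[]⁺ b _ 0∈b here)
    ... | suc zero , _   , x∈ = ⊥-elim (constTerm-closed e′ pe′ x x∈)

    LeftUnit⇒∈ᴹ-⟪⟫ʳ : LeftUnit 𝕋 b e′ pe′ → ∀ x y → y ∈ᴹ ⟪ b ⟫ x y
    LeftUnit⇒∈ᴹ-⟪⟫ʳ unit x y with ∈var-[]⁻ b _ (Prov-∈var closedStable e pe (psym (unit y)) here)
    ... | zero     , _   , y∈ = ⊥-elim (constTerm-closed e′ pe′ y y∈)
    ... | suc zero , 1∈b , _  = ∈ᴹ-φ⁺ (∈var-[]⁺ b _ 1∈b here)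

module NoDistributiveLaw
  {𝕊 𝕋 : Theory} {S T : Monad} (PS : Presents 𝕊 S) (PT : Presents 𝕋 T)
  (closedStableˢ : ClosedStable 𝕊) (varStableᵀ : VarStable 𝕋)
  {es : Op (sig 𝕊)} (pes : arity (sig 𝕊) es ≡ 0)
  (t : Term (sig 𝕋) (Fin 2)) {et : Op (sig 𝕋)} {pet : arity (sig 𝕋) et ≡ 0}
  (unitʳᵗ : RightUnit 𝕋 t et pet) (unitˡᵗ : LeftUnit 𝕋 t et pet)
  (DL : DistributiveLaw S T) where

  module S = Monad S
  module T = Monad T
  module PS = Presents PS
  module PT = Presents PT
  module 𝕊ᴾ = Presented PS
  module 𝕋ᴾ = Presented PT
  module Pˢ = Provability 𝕊
  open Provability 𝕋
  open Support PS closedStableˢ es pes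
  open DistributiveLaw DL using (λ′; nat; law-ηS; law-ηT; law-μS)
  open DistributiveLawProperties DL
  open 𝕊ᴾ using () renaming (⟪_⟫ to ⟪_⟫ˢ)

  Eˢ : Term (sig 𝕊) X
  Eˢ = constTerm es pes

  Eᵗ : Term (sig 𝕋) X
  Eᵗ = constTerm et pet

  infixl 6 _⊕_
  _⊕_ : Term (sig 𝕋) X → Term (sig 𝕋) X → Term (sig 𝕋) X
  _⊕_ = apply₂ t

  ⟪t⟫ : X → X → T.F X
  ⟪t⟫ = 𝕋ᴾ.⟪ t ⟫

  module DistributeLeft (s : Term (sig 𝕊) (Fin 2)) (unitʳˢ : RightUnit 𝕊 s es pes)
                        {p q r : ℕ} (p≢q : ¬ p ≡ q) (p≢r : ¬ p ≡ r) (q≢r : ¬ q ≡ r) where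

    Λ : T.F (S.F ℕ)
    Λ = λ′ (⟪ s ⟫ˢ (⟪t⟫ p q) (T.η r))

    A B : S.F ℕ
    A = ⟪ s ⟫ˢ p r
    B = ⟪ s ⟫ˢ q r

    erase : S.F ℕ → S.F ℕ
    erase ℓ = S.μ (S.fmap (PS.φ ∘ (r ↦ Eˢ)) ℓ)

    erase-φ : (u : Term (sig 𝕊) ℕ) → erase (PS.φ u) ≡ PS.φ (u [ r ↦ Eˢ ])
    erase-φ u = sym (𝕊ᴾ.φ-[] u (r ↦ Eˢ) (λ _ → refl))

    erase-⟪⟫ : ∀ {n} → ¬ n ≡ r → erase (⟪ s ⟫ˢ n r) ≡ S.η n
    erase-⟪⟫ {n} n≢r = trans (erase-φ _) (trans (PS.φ-sound n⊗e≈n) (PS.φ-η n))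
      where
        n⊗e≈n : Prov 𝕊 (apply₂ s (var n) (var r) [ r ↦ Eˢ ]) (var n)
        n⊗e≈n = ptrans (Pˢ.apply₂-[] s (var n) (var r) (r ↦ Eˢ))
                  (ptrans (Pˢ.apply₂-cong s (Pˢ.≡⇒Prov (↦-there Eˢ n≢r)) (Pˢ.≡⇒Prov (↦-here r Eˢ))) (unitʳˢ n))

    erase-∈ᴹ : ∀ {n} → ¬ n ≡ r → ∀ ℓ → n ∈ᴹ ℓ → n ∈ᴹ erase ℓ
    erase-∈ᴹ {n} n≢r ℓ n∈ℓ =
      subst (n ∈ᴹ_) (trans (sym (erase-φ (𝕊ᴾ.rep ℓ))) (cong erase (𝕊ᴾ.φ-rep ℓ)))
        (∈ᴹ-φ⁺ (∈var-[]⁺ (𝕊ᴾ.rep ℓ) (r ↦ Eˢ) n∈ℓ (subst (n ∈var_) (sym (↦-there Eˢ n≢r)) here)))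

    fmap-erase-Λ : T.fmap erase Λ ≡ T.fmap S.η (⟪t⟫ p q)
    fmap-erase-Λ = begin
      T.fmap erase Λ                                                ≡⟨ T.fmap-∘ S.μ (S.fmap ρ) Λ ⟩
      T.fmap S.μ (T.fmap (S.fmap ρ) Λ)                              ≡⟨ cong (T.fmap S.μ) (nat ρ _) ⟨
      T.fmap S.μ (λ′ (S.fmap (T.fmap ρ) (⟪ s ⟫ˢ (⟪t⟫ p q) (T.η r))))  ≡⟨ cong (T.fmap S.μ ∘ λ′) (𝕊ᴾ.fmap-⟪⟫ (T.fmap ρ) s _ _) ⟩
      T.fmap S.μ (λ′ (⟪ s ⟫ˢ (T.fmap ρ (⟪t⟫ p q)) (T.fmap ρ (T.η r))))  ≡⟨ cong (T.fmap S.μ ∘ λ′) (cong₂ ⟪ s ⟫ˢ ρ-pq ρ-r) ⟩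
      T.fmap S.μ (λ′ (⟪ s ⟫ˢ (λ′ (S.η (⟪t⟫ p q))) (λ′ (PS.φ Eˢ))))  ≡⟨ cong (T.fmap S.μ ∘ λ′) (𝕊ᴾ.fmap-⟪⟫ λ′ s _ _) ⟨
      T.fmap S.μ (λ′ (S.fmap λ′ (⟪ s ⟫ˢ (S.η (⟪t⟫ p q)) (PS.φ Eˢ))))  ≡⟨ law-μS _ ⟨
      λ′ (S.μ (⟪ s ⟫ˢ (S.η (⟪t⟫ p q)) (PS.φ Eˢ)))                     ≡⟨ cong λ′ μ-⟪η,e⟫ ⟩
      λ′ (S.η (⟪t⟫ p q))                                            ≡⟨ law-ηS _ ⟩
      T.fmap S.η (⟪t⟫ p q)                                           ∎
      where
        open ≡-Reasoning
        ρ : ℕ → S.F ℕ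
        ρ = PS.φ ∘ (r ↦ Eˢ)

        ρ-η : ∀ {n} → ¬ n ≡ r → ρ n ≡ S.η n
        ρ-η n≢r = trans (cong PS.φ (↦-there Eˢ n≢r)) (PS.φ-η _)

        ρ-pq : T.fmap ρ (⟪t⟫ p q) ≡ λ′ (S.η (⟪t⟫ p q))
        ρ-pq = trans (𝕋ᴾ.fmap-⟪⟫ ρ t p q)
                 (trans (cong₂ ⟪t⟫ (ρ-η p≢r) (ρ-η q≢r))
                   (trans (sym (𝕋ᴾ.fmap-⟪⟫ S.η t p q)) (sym (law-ηS _))))

        ρ-r : T.fmap ρ (T.η r) ≡ λ′ (PS.φ Eˢ)
        ρ-r = trans (T.η-nat ρ r)
                (trans (cong (T.η ∘ PS.φ) (↦-here r Eˢ))
                  (trans (sym (law-ηT _)) (cong λ′ (𝕊ᴾ.fmap-φ-constTerm es pes T.η))))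

        μ-⟪η,e⟫ : S.μ (⟪ s ⟫ˢ (S.η (⟪t⟫ p q)) (PS.φ Eˢ)) ≡ S.η (⟪t⟫ p q)
        μ-⟪η,e⟫ = trans (cong (λ x → S.μ (⟪ s ⟫ˢ x (PS.φ Eˢ))) (sym (PS.φ-η _)))
                    (trans (𝕊ᴾ.μ-⟪⟫ s (var _) Eˢ) (trans (PS.φ-sound (unitʳˢ _)) (PS.φ-η _)))

    rΛ : Term (sig 𝕋) (S.F ℕ)
    rΛ = 𝕋ᴾ.rep Λ

    rename-erase-rΛ : Prov 𝕋 (rename erase rΛ) (var (S.η p) ⊕ var (S.η q))
    rename-erase-rΛ = PT.φ-complete (begin
      PT.φ (rename erase rΛ)             ≡⟨ PT.φ-nat erase rΛ ⟩
      T.fmap erase (PT.φ rΛ)             ≡⟨ cong (T.fmap erase) (𝕋ᴾ.φ-rep Λ) ⟩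
      T.fmap erase Λ                     ≡⟨ fmap-erase-Λ ⟩
      T.fmap S.η (⟪t⟫ p q)               ≡⟨ 𝕋ᴾ.fmap-⟪⟫ S.η t p q ⟩
      PT.φ (var (S.η p) ⊕ var (S.η q))   ∎)
      where open ≡-Reasoning

    module Eliminate (k o : ℕ) (k≢r : ¬ k ≡ r)
                     (eliminated : Prov 𝕋 ((var p ⊕ var q) [ k ↦ Eᵗ ]) (var o)) where

      h : ℕ → T.F ℕ
      h = PT.φ ∘ (k ↦ Eᵗ)

      h-η : ∀ {n} → ¬ n ≡ k → h n ≡ T.η n
      h-η n≢k = trans (cong PT.φ (↦-there Eᵗ n≢k)) (PT.φ-η _)

      λ-bind-h : λ′ (S.fmap (T.μ ∘ T.fmap h) (⟪ s ⟫ˢ (⟪t⟫ p q) (T.η r))) ≡ T.η (⟪ s ⟫ˢ o r)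
      λ-bind-h = begin
        λ′ (S.fmap (T.μ ∘ T.fmap h) (⟪ s ⟫ˢ (⟪t⟫ p q) (T.η r)))                  ≡⟨ cong λ′ (𝕊ᴾ.fmap-⟪⟫ _ s _ _) ⟩
        λ′ (⟪ s ⟫ˢ (T.μ (T.fmap h (⟪t⟫ p q))) (T.μ (T.fmap h (T.η r))))          ≡⟨ cong λ′ (cong₂ ⟪ s ⟫ˢ h-pq h-r) ⟩
        λ′ (⟪ s ⟫ˢ (T.η o) (T.η r))                                              ≡⟨ cong λ′ (𝕊ᴾ.fmap-⟪⟫ T.η s o r) ⟨
        λ′ (S.fmap T.η (⟪ s ⟫ˢ o r))                                             ≡⟨ law-ηT _ ⟩
        T.η (⟪ s ⟫ˢ o r)                                                         ∎
        where
          open ≡-Reasoning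
          h-pq : T.μ (T.fmap h (⟪t⟫ p q)) ≡ T.η o
          h-pq = trans (sym (𝕋ᴾ.φ-[] (var p ⊕ var q) (k ↦ Eᵗ) (λ _ → refl)))
                   (trans (PT.φ-sound eliminated) (PT.φ-η o))
          h-r : T.μ (T.fmap h (T.η r)) ≡ T.η r
          h-r = trans (cong T.μ (T.η-nat h r)) (trans (T.unit-l (h r)) (h-η (k≢r ∘ sym)))

      Θ : S.F ℕ → T.F (S.F ℕ)
      Θ ℓ = λ′ (S.fmap h ℓ)

      Θ-η : ∀ ℓ → ¬ k ∈ᴹ ℓ → Θ ℓ ≡ T.η ℓ
      Θ-η ℓ k∉ℓ = trans (cong λ′ (𝕊ᴾ.fmap-cong ℓ (λ n n∈ℓ → h-η (λ { refl → k∉ℓ n∈ℓ })))) (law-ηT ℓ)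

      -- a variable wherever Θ is the unit, so that those leaves of rΛ survive in rΛ [ θ ]
      θ : S.F ℕ → Term (sig 𝕋) (S.F ℕ)
      θ ℓ = if k ∈ᴹ ℓ then 𝕋ᴾ.rep (Θ ℓ) else var ℓ

      φ-θ : ∀ ℓ → PT.φ (θ ℓ) ≡ Θ ℓ
      φ-θ ℓ = by-cases (k ∈ᴹ? ℓ)
        where
          by-cases : Dec (k ∈ᴹ ℓ) → PT.φ (θ ℓ) ≡ Θ ℓ
          by-cases (yes k∈ℓ) = trans (cong PT.φ (if-∈ᴹ k∈ℓ)) (𝕋ᴾ.φ-rep (Θ ℓ))
          by-cases (no k∉ℓ)  = trans (cong PT.φ (if-∉ᴹ k∉ℓ)) (trans (PT.φ-η ℓ) (sym (Θ-η ℓ k∉ℓ)))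

      rΛ[θ] : Prov 𝕋 (rΛ [ θ ]) (var (⟪ s ⟫ˢ o r))
      rΛ[θ] = PT.φ-complete (begin
        PT.φ (rΛ [ θ ])                                          ≡⟨ 𝕋ᴾ.φ-[] rΛ θ φ-θ ⟩
        T.μ (T.fmap Θ (PT.φ rΛ))                                 ≡⟨ cong (T.μ ∘ T.fmap Θ) (𝕋ᴾ.φ-rep Λ) ⟩
        T.μ (T.fmap Θ Λ)                                         ≡⟨ λ-fmap-bind h _ ⟨
        λ′ (S.fmap (T.μ ∘ T.fmap h) (⟪ s ⟫ˢ (⟪t⟫ p q) (T.η r)))  ≡⟨ λ-bind-h ⟩
        T.η (⟪ s ⟫ˢ o r)                                         ≡⟨ PT.φ-η _ ⟨
        PT.φ (var (⟪ s ⟫ˢ o r))                                  ∎)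
        where open ≡-Reasoning

      leaf : ∀ ℓ → ℓ ∈var rΛ → ¬ k ∈ᴹ ℓ → DoubleNegation (ℓ ≡ ⟪ s ⟫ˢ o r)
      leaf ℓ ℓ∈rΛ k∉ℓ = VarStable⇒¬¬ varStableᵀ (rΛ [ θ ]) _ rΛ[θ] ℓ
                          (∈var-[]⁺ rΛ θ ℓ∈rΛ (subst (ℓ ∈var_) (sym (if-∉ᴹ k∉ℓ)) here))

    p∉ηq : ¬ p ∈ᴹ S.η q
    p∉ηq = p≢q ∘ ∈ᴹ-η⁻

    module WithoutQ = Eliminate q p q≢r
      (ptrans (apply₂-[] t (var p) (var q) _)
        (ptrans (apply₂-cong t (≡⇒Prov (↦-there Eᵗ p≢q)) (≡⇒Prov (↦-here q Eᵗ))) (unitʳᵗ p)))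

    module WithoutP = Eliminate p q p≢r
      (ptrans (apply₂-[] t (var p) (var q) _)
        (ptrans (apply₂-cong t (≡⇒Prov (↦-here p Eᵗ)) (≡⇒Prov (↦-there Eᵗ (p≢q ∘ sym)))) (unitˡᵗ q)))

    -- after erasing r a leaf mentioning p collapses to η p, so it cannot also mention q
    no-leaf-mentions-both : ∀ ℓ → ℓ ∈var rΛ → p ∈ᴹ ℓ → q ∈ᴹ ℓ → ⊥
    no-leaf-mentions-both ℓ ℓ∈rΛ p∈ℓ q∈ℓ =
      VarStable⇒¬¬ varStableᵀ _ (S.η p) kill-q (erase ℓ)
        (∈var-[]⁺ (rename erase rΛ) κ (∈var-[]⁺ rΛ (var ∘ erase) ℓ∈rΛ here)
          (subst (erase ℓ ∈var_) (sym (if-∈ᴹ (erase-∈ᴹ p≢r ℓ p∈ℓ))) here))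
        (λ eℓ≡ηp → p≢q (sym (∈ᴹ-η⁻ (subst (q ∈ᴹ_) eℓ≡ηp (erase-∈ᴹ q≢r ℓ q∈ℓ)))))
      where
        κ : S.F ℕ → Term (sig 𝕋) (S.F ℕ)
        κ ℓ′ = if p ∈ᴹ ℓ′ then var ℓ′ else Eᵗ

        kill-q : Prov 𝕋 (rename erase rΛ [ κ ]) (var (S.η p))
        kill-q = begin
          rename erase rΛ [ κ ]                      ≈⟨ []-congˡ κ rename-erase-rΛ ⟩
          (var (S.η p) ⊕ var (S.η q)) [ κ ]          ≈⟨ apply₂-[] t _ _ κ ⟩
          κ (S.η p) ⊕ κ (S.η q)                      ≈⟨ apply₂-cong t (≡⇒Prov (if-∈ᴹ (∈ᴹ-η p))) (≡⇒Prov (if-∉ᴹ p∉ηq)) ⟩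
          var (S.η p) ⊕ Eᵗ                           ≈⟨ unitʳᵗ (S.η p) ⟩
          var (S.η p)                                ∎
          where open ≈-Reasoning

    leaf-cases : ∀ ℓ → ℓ ∈var rΛ → DoubleNegation (ℓ ≡ A ⊎ ℓ ≡ B)
    leaf-cases ℓ ℓ∈rΛ with q ∈ᴹ? ℓ | p ∈ᴹ? ℓ
    ... | no q∉ℓ  | _        = inj₁ <$> WithoutQ.leaf ℓ ℓ∈rΛ q∉ℓ
    ... | yes _   | no p∉ℓ   = inj₂ <$> WithoutP.leaf ℓ ℓ∈rΛ p∉ℓ
    ... | yes q∈ℓ | yes p∈ℓ  = ⊥-elim (no-leaf-mentions-both ℓ ℓ∈rΛ p∈ℓ q∈ℓ)

    restore : S.F ℕ → S.F ℕ
    restore ℓ = if p ∈ᴹ ℓ then A else B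

    restore-erase : ∀ ℓ → ℓ ≡ A ⊎ ℓ ≡ B → restore (erase ℓ) ≡ ℓ
    restore-erase _ (inj₁ refl) = trans (cong restore (erase-⟪⟫ p≢r)) (if-∈ᴹ (∈ᴹ-η p))
    restore-erase _ (inj₂ refl) = trans (cong restore (erase-⟪⟫ q≢r)) (if-∉ᴹ p∉ηq)

    rΛ≈A⊕B : (∀ ℓ → ℓ ∈var rΛ → restore (erase ℓ) ≡ ℓ) → Prov 𝕋 rΛ (var A ⊕ var B)
    rΛ≈A⊕B restore-erase-rΛ = begin
      rΛ                                         ≈⟨ []-identity rΛ ⟨
      rΛ [ var ]                                 ≈⟨ []-congʳ rΛ (λ ℓ ℓ∈ → ≡⇒Prov (cong var (restore-erase-rΛ ℓ ℓ∈))) ⟨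
      rΛ [ var ∘ restore ∘ erase ]               ≈⟨ []-assoc rΛ (var ∘ erase) (var ∘ restore) ⟨
      rename restore (rename erase rΛ)           ≈⟨ []-congˡ (var ∘ restore) rename-erase-rΛ ⟩
      rename restore (var (S.η p) ⊕ var (S.η q)) ≈⟨ apply₂-[] t _ _ (var ∘ restore) ⟩
      var (restore (S.η p)) ⊕ var (restore (S.η q))
        ≈⟨ apply₂-cong t (≡⇒Prov (cong var (if-∈ᴹ (∈ᴹ-η p)))) (≡⇒Prov (cong var (if-∉ᴹ p∉ηq))) ⟩
      var A ⊕ var B                              ∎
      where open ≈-Reasoning

    λ-distribˡ : DoubleNegation (λ′ (⟪ s ⟫ˢ (⟪t⟫ p q) (T.η r)) ≡ ⟪t⟫ A B)
    λ-distribˡ = (λ restore-erase-rΛ → trans (sym (𝕋ᴾ.φ-rep Λ)) (PT.φ-sound (rΛ≈A⊕B restore-erase-rΛ)))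
      <$> ¬¬-∀∈var rΛ (λ ℓ ℓ∈rΛ → restore-erase ℓ <$> leaf-cases ℓ ℓ∈rΛ)

  open DistributeLeft using (λ-distribˡ)

  λ-distribʳ : (s : Term (sig 𝕊) (Fin 2)) → LeftUnit 𝕊 s es pes →
               {p q r : ℕ} → ¬ p ≡ q → ¬ r ≡ p → ¬ r ≡ q →
               DoubleNegation (λ′ (⟪ s ⟫ˢ (T.η r) (⟪t⟫ p q)) ≡ ⟪t⟫ (⟪ s ⟫ˢ r p) (⟪ s ⟫ˢ r q))
  λ-distribʳ s unitˡˢ p≢q r≢p r≢q =
    (λ e → trans (cong λ′ (sym (𝕊ᴾ.⟪opposite⟫ s _ _)))
             (trans e (cong₂ ⟪t⟫ (𝕊ᴾ.⟪opposite⟫ s _ _) (𝕊ᴾ.⟪opposite⟫ s _ _))))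
      <$> λ-distribˡ (opposite s) (LeftUnit⇒RightUnit-opposite s unitˡˢ) p≢q (r≢p ∘ sym) (r≢q ∘ sym)

  square : X → X → X → X → Term (sig 𝕋) X
  square a b c d = (var a ⊕ var b) ⊕ (var c ⊕ var d)

  square-≡ : {a a′ b b′ c c′ d d′ : X} → a ≡ a′ → b ≡ b′ → c ≡ c′ → d ≡ d′ →
             square a b c d ≡ square a′ b′ c′ d′
  square-≡ refl refl refl refl = refl

  rename-square : (f : X → Y) (a b c d : X) → Prov 𝕋 (rename f (square a b c d)) (square (f a) (f b) (f c) (f d))
  rename-square f a b c d =
    ptrans (apply₂-[] t _ _ (var ∘ f)) (apply₂-cong t (apply₂-[] t _ _ (var ∘ f)) (apply₂-[] t _ _ (var ∘ f)))

  -- r is a fresh variable: substituting t(p′,q′) for it splits the left-hand side into the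
  -- shape of λ-distribˡ, and each resulting summand into the shape of λ-distribʳ
  λ-distrib² : (s : Term (sig 𝕊) (Fin 2)) → RightUnit 𝕊 s es pes → LeftUnit 𝕊 s es pes →
               {p q p′ q′ r : ℕ} → ¬ p ≡ q → ¬ p′ ≡ q′ → ¬ p ≡ r → ¬ q ≡ r →
               ¬ p ≡ p′ → ¬ p ≡ q′ → ¬ q ≡ p′ → ¬ q ≡ q′ →
               DoubleNegation (λ′ (⟪ s ⟫ˢ (⟪t⟫ p q) (⟪t⟫ p′ q′)) ≡
                 PT.φ (square (⟪ s ⟫ˢ p p′) (⟪ s ⟫ˢ p q′) (⟪ s ⟫ˢ q p′) (⟪ s ⟫ˢ q q′)))
  λ-distrib² s unitʳˢ unitˡˢ {p} {q} {p′} {q′} {r} p≢q p′≢q′ p≢r q≢r p≢p′ p≢q′ q≢p′ q≢q′ = do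
    split  ← λ-distribˡ s unitʳˢ p≢q p≢r q≢r
    splitᵖ ← λ-distribʳ s unitˡˢ p′≢q′ p≢p′ p≢q′
    splitᵠ ← λ-distribʳ s unitˡˢ p′≢q′ q≢p′ q≢q′
    pure (begin
      λ′ (⟪ s ⟫ˢ (⟪t⟫ p q) (⟪t⟫ p′ q′))                                ≡⟨ cong λ′ (cong₂ ⟪ s ⟫ˢ h-pq h-r) ⟨
      λ′ (⟪ s ⟫ˢ (T.μ (T.fmap h (⟪t⟫ p q))) (T.μ (T.fmap h (T.η r))))  ≡⟨ cong λ′ (𝕊ᴾ.fmap-⟪⟫ _ s _ _) ⟨
      λ′ (S.fmap (T.μ ∘ T.fmap h) (⟪ s ⟫ˢ (⟪t⟫ p q) (T.η r)))          ≡⟨ λ-fmap-bind h _ ⟩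
      T.μ (T.fmap Ψ (λ′ (⟪ s ⟫ˢ (⟪t⟫ p q) (T.η r))))                   ≡⟨ cong (T.μ ∘ T.fmap Ψ) split ⟩
      T.μ (T.fmap Ψ (⟪t⟫ (⟪ s ⟫ˢ p r) (⟪ s ⟫ˢ q r)))                   ≡⟨ cong T.μ (𝕋ᴾ.fmap-⟪⟫ Ψ t _ _) ⟩
      T.μ (⟪t⟫ (Ψ (⟪ s ⟫ˢ p r)) (Ψ (⟪ s ⟫ˢ q r)))                      ≡⟨ cong T.μ (cong₂ ⟪t⟫ (Ψ-⟪⟫ p≢r splitᵖ) (Ψ-⟪⟫ q≢r splitᵠ)) ⟩
      T.μ (⟪t⟫ (⟪t⟫ (⟪ s ⟫ˢ p p′) (⟪ s ⟫ˢ p q′)) (⟪t⟫ (⟪ s ⟫ˢ q p′) (⟪ s ⟫ˢ q q′)))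
                                                                       ≡⟨ 𝕋ᴾ.μ-⟪⟫ t _ _ ⟩
      PT.φ (square (⟪ s ⟫ˢ p p′) (⟪ s ⟫ˢ p q′) (⟪ s ⟫ˢ q p′) (⟪ s ⟫ˢ q q′))  ∎)
    where
      open ≡-Reasoning

      h : ℕ → T.F ℕ
      h = PT.φ ∘ (r ↦ (var p′ ⊕ var q′))

      Ψ : S.F ℕ → T.F (S.F ℕ)
      Ψ = λ′ ∘ S.fmap h

      h-η : ∀ {n} → ¬ n ≡ r → h n ≡ T.η n
      h-η n≢r = trans (cong PT.φ (↦-there _ n≢r)) (PT.φ-η _)

      h-pq : T.μ (T.fmap h (⟪t⟫ p q)) ≡ ⟪t⟫ p q
      h-pq = trans (sym (𝕋ᴾ.φ-[] (var p ⊕ var q) (r ↦ (var p′ ⊕ var q′)) (λ _ → refl)))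
               (PT.φ-sound (ptrans (apply₂-[] t _ _ _)
                 (apply₂-cong t (≡⇒Prov (↦-there _ p≢r)) (≡⇒Prov (↦-there _ q≢r)))))

      h-r : T.μ (T.fmap h (T.η r)) ≡ ⟪t⟫ p′ q′
      h-r = trans (cong T.μ (T.η-nat h r)) (trans (T.unit-l (h r)) (cong PT.φ (↦-here r _)))

      Ψ-⟪⟫ : ∀ {n} → ¬ n ≡ r → λ′ (⟪ s ⟫ˢ (T.η n) (⟪t⟫ p′ q′)) ≡ ⟪t⟫ (⟪ s ⟫ˢ n p′) (⟪ s ⟫ˢ n q′) →
             Ψ (⟪ s ⟫ˢ n r) ≡ ⟪t⟫ (⟪ s ⟫ˢ n p′) (⟪ s ⟫ˢ n q′)
      Ψ-⟪⟫ {n} n≢r splitⁿ =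
        trans (cong λ′ (trans (𝕊ᴾ.fmap-⟪⟫ h s n r) (cong₂ ⟪ s ⟫ˢ (h-η n≢r) (cong PT.φ (↦-here r _)))))
          splitⁿ

  module _ (s : Term (sig 𝕊) (Fin 2)) (unitʳˢ : RightUnit 𝕊 s es pes) (unitˡˢ : LeftUnit 𝕊 s es pes) where

    expand : DoubleNegation (λ′ (⟪ s ⟫ˢ (⟪t⟫ 0 1) (⟪t⟫ 2 3)) ≡
                               PT.φ (square (⟪ s ⟫ˢ 0 2) (⟪ s ⟫ˢ 0 3) (⟪ s ⟫ˢ 1 2) (⟪ s ⟫ˢ 1 3)))
    expand = λ-distrib² s unitʳˢ unitˡˢ {r = 4} (λ ()) (λ ()) (λ ()) (λ ()) (λ ()) (λ ()) (λ ()) (λ ())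

    expandᵒᵖ : DoubleNegation (λ′ (⟪ s ⟫ˢ (⟪t⟫ 0 1) (⟪t⟫ 2 3)) ≡
                                 PT.φ (square (⟪ s ⟫ˢ 0 2) (⟪ s ⟫ˢ 1 2) (⟪ s ⟫ˢ 0 3) (⟪ s ⟫ˢ 1 3)))
    expandᵒᵖ =
      (λ e → trans (cong λ′ (sym (𝕊ᴾ.⟪opposite⟫ s _ _))) (trans e (cong PT.φ (square-≡ swap swap swap swap))))
        <$> λ-distrib² (opposite s) (LeftUnit⇒RightUnit-opposite s unitˡˢ)
                       (RightUnit⇒LeftUnit-opposite s unitʳˢ)
                       {r = 4} (λ ()) (λ ()) (λ ()) (λ ()) (λ ()) (λ ()) (λ ()) (λ ())
      where
        swap : ∀ {x y} → 𝕊ᴾ.⟪ opposite s ⟫ x y ≡ ⟪ s ⟫ˢ y x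
        swap = 𝕊ᴾ.⟪opposite⟫ s _ _

    -- tells the four elements ⟪ s ⟫ˢ x z (x ∈ {0,1}, z ∈ {2,3}) apart by which of 0 and 2 they
    -- contain, since S.F ℕ need not have decidable equality
    quadrant : S.F ℕ → ℕ
    quadrant ℓ = if 0 ∈ᴹ ℓ then (if 2 ∈ᴹ ℓ then 0 else 2) else (if 2 ∈ᴹ ℓ then 1 else 3)

    rename-quadrant : ∀ {a b c d : S.F ℕ} {i j k l : ℕ} →
                      quadrant a ≡ i → quadrant b ≡ j → quadrant c ≡ k → quadrant d ≡ l →
                      Prov 𝕋 (rename quadrant (square a b c d)) (square i j k l)
    rename-quadrant qa qb qc qd = ptrans (rename-square quadrant _ _ _ _) (≡⇒Prov (square-≡ qa qb qc qd))

    quadrant-02 : quadrant (⟪ s ⟫ˢ 0 2) ≡ 0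
    quadrant-02 = trans (if-∈ᴹ (RightUnit⇒∈ᴹ-⟪⟫ˡ s unitʳˢ 0 2)) (if-∈ᴹ (LeftUnit⇒∈ᴹ-⟪⟫ʳ s unitˡˢ 0 2))

    quadrant-03 : quadrant (⟪ s ⟫ˢ 0 3) ≡ 2
    quadrant-03 = trans (if-∈ᴹ (RightUnit⇒∈ᴹ-⟪⟫ˡ s unitʳˢ 0 3)) (if-∉ᴹ (∉ᴹ-⟪⟫ s (λ ()) (λ ())))

    quadrant-12 : quadrant (⟪ s ⟫ˢ 1 2) ≡ 1
    quadrant-12 = trans (if-∉ᴹ (∉ᴹ-⟪⟫ s (λ ()) (λ ()))) (if-∈ᴹ (LeftUnit⇒∈ᴹ-⟪⟫ʳ s unitˡˢ 1 2))

    quadrant-13 : quadrant (⟪ s ⟫ˢ 1 3) ≡ 3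
    quadrant-13 = trans (if-∉ᴹ (∉ᴹ-⟪⟫ s (λ ()) (λ ()))) (if-∉ᴹ (∉ᴹ-⟪⟫ s (λ ()) (λ ())))

    medial-0213 : λ′ (⟪ s ⟫ˢ (⟪t⟫ 0 1) (⟪t⟫ 2 3)) ≡ PT.φ (square (⟪ s ⟫ˢ 0 2) (⟪ s ⟫ˢ 0 3) (⟪ s ⟫ˢ 1 2) (⟪ s ⟫ˢ 1 3)) →
                  λ′ (⟪ s ⟫ˢ (⟪t⟫ 0 1) (⟪t⟫ 2 3)) ≡ PT.φ (square (⟪ s ⟫ˢ 0 2) (⟪ s ⟫ˢ 1 2) (⟪ s ⟫ˢ 0 3) (⟪ s ⟫ˢ 1 3)) →
                  Prov 𝕋 (square 0 2 1 3) (square 0 1 2 3)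
    medial-0213 e e′ = begin
      square 0 2 1 3                                                         ≈⟨ rename-quadrant quadrant-02 quadrant-03 quadrant-12 quadrant-13 ⟨
      rename quadrant (square (⟪ s ⟫ˢ 0 2) (⟪ s ⟫ˢ 0 3) (⟪ s ⟫ˢ 1 2) (⟪ s ⟫ˢ 1 3))  ≈⟨ []-congˡ (var ∘ quadrant) (PT.φ-complete (trans (sym e) e′)) ⟩
      rename quadrant (square (⟪ s ⟫ˢ 0 2) (⟪ s ⟫ˢ 1 2) (⟪ s ⟫ˢ 0 3) (⟪ s ⟫ˢ 1 3))  ≈⟨ rename-quadrant quadrant-02 quadrant-12 quadrant-03 quadrant-13 ⟩
      square 0 1 2 3                                                         ∎
      where open ≈-Reasoning

    no-distributive-law : MedialRestricted 𝕋 t → ⊥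
    no-distributive-law medial = expand λ e → expandᵒᵖ λ e′ → 0213-not-three (medial 0 2 1 3 (medial-0213 e e′))
      where
        0213-not-three : ¬ AtMostThreeDistinct 0 2 1 3
        0213-not-three (inj₁ ())
        0213-not-three (inj₂ (inj₁ ()))
        0213-not-three (inj₂ (inj₂ (inj₁ ())))
        0213-not-three (inj₂ (inj₂ (inj₂ (inj₁ ()))))
        0213-not-three (inj₂ (inj₂ (inj₂ (inj₂ (inj₁ ())))))
        0213-not-three (inj₂ (inj₂ (inj₂ (inj₂ (inj₂ ())))))

corollary4p17 : (𝕊 𝕋 : Theory) (S T : Monad) →
    Presents 𝕊 S → Presents 𝕋 T →
    ClosedStable 𝕊 → VarStable 𝕊 → Cancellative 𝕊 →
    ClosedStable 𝕋 → VarStable 𝕋 →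
    HasConstant 𝕋 →
    (∃ λ (s : Term (sig 𝕊) (Fin 2)) → ∃ λ (es : Op (sig 𝕊)) → ∃ λ (pes : arity (sig 𝕊) es ≡ 0) →
     ∃ λ (t : Term (sig 𝕋) (Fin 2)) → ∃ λ (et : Op (sig 𝕋)) → ∃ λ (pet : arity (sig 𝕋) et ≡ 0) →
       HasUnit 𝕊 s es pes × HasUnit 𝕋 t et pet × MedialRestricted 𝕋 t) →
    ¬ DistributiveLaw S T
corollary4p17 𝕊 𝕋 S T PS PT closedStableˢ _ _ _ varStableᵀ _ (s , es , pes , t , et , pet , unitˢ , unitᵗ , medial) DL =
  NoDistributiveLaw.no-distributive-law PS PT closedStableˢ varStableᵀ pes t
    (HasUnit⇒RightUnit t unitᵗ) (HasUnit⇒LeftUnit t unitᵗ) DL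
    s (HasUnit⇒RightUnit s unitˢ) (HasUnit⇒LeftUnit s unitˢ) medial
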